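{- Let $P$ be a poset such that $A'=\operatorname{cl}_\sigma(A)$ for every subset $A\subseteq P$. Then for each $x\in P$, $\operatorname{int}_\sigma(\mathord{\uparrow}x)=\{y\in P\mid x\ll y\}$.
   Context: $\mathord{\downarrow}X=\{z\mid \exists y\in X,\ z\le y\}$, $\mathord{\uparrow}x=\{z\mid x\le z\}$. A subset is directed if nonempty and every finite subset has an upper bound in it. For $A\subseteq P$, $A'=\{x\in P\mid x=\bigvee D \text{ for some directed } D\subseteq\mathord{\downarrow}A\}$. $x\ll y$ iff for every directed $D\subseteq P$ whose supremum exists with $\bigvee D\ge y$, there is $d\in D$ with $x\le d$. A set $U$ is Scott open if it is an upper set and whenever $D$ is directed with $\bigvee D$ existing and in $U$, then $D\cap U\ne\emptyset$; $\operatorname{int}_\sigma$, $\operatorname{cl}_\sigma$ denote Scott interior and closure. -}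

module Defs where

open import Level using (Level; suc; _⊔_)
open import Data.Product using (Σ; ∃; _×_; _,_)
open import Relation.Unary using (Pred; _∈_; _⊆_; ∁)
open import Relation.Binary.Bundles using (Poset)

module PosetNotions {ℓ : Level} (P : Poset ℓ ℓ ℓ) where
  open Poset P renaming (Carrier to X)

  Subset : Set (suc ℓ)
  Subset = Pred X ℓ

  ↓ : Subset → Subset
  ↓ A z = ∃ λ y → y ∈ A × z ≤ y

  ↑ : X → Subset
  ↑ x z = x ≤ z

  Directed : Subset → Set ℓ
  Directed D = (∃ λ d → d ∈ D)
             × (∀ a b → a ∈ D → b ∈ D → ∃ λ c → c ∈ D × a ≤ c × b ≤ c)

  IsSup : Subset → X → Set ℓ
  IsSup D s = (∀ d → d ∈ D → d ≤ s)
            × (∀ u → (∀ d → d ∈ D → d ≤ u) → s ≤ u)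

  _′ : Subset → Pred X (suc ℓ)
  (A ′) x = ∃ λ (D : Subset) → Directed D × D ⊆ ↓ A × IsSup D x

  _≪_ : X → X → Set (suc ℓ)
  x ≪ y = ∀ (D : Subset) → Directed D → ∀ s → IsSup D s → y ≤ s →
          ∃ λ d → d ∈ D × x ≤ d

  UpperSet : Subset → Set ℓ
  UpperSet U = ∀ x y → x ∈ U → x ≤ y → y ∈ U

  ScottOpen : Subset → Set (suc ℓ)
  ScottOpen U = UpperSet U
              × (∀ (D : Subset) → Directed D → ∀ s → IsSup D s → s ∈ U →
                 ∃ λ d → d ∈ D × d ∈ U)

  ScottClosed : Subset → Set (suc ℓ)
  ScottClosed C = ScottOpen (∁ C)

  int-σ : Subset → Pred X (suc ℓ)
  int-σ U y = ∃ λ (V : Subset) → ScottOpen V × V ⊆ U × y ∈ V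

  cl-σ : Subset → Pred X (suc ℓ)
  cl-σ A x = ∀ (C : Subset) → ScottClosed C → A ⊆ C → x ∈ C

  _≐_ : ∀ {a b} → Pred X a → Pred X b → Set _
  A ≐ B = A ⊆ B × B ⊆ A

-- If x ≪ y, then y is not the supremum of a directed subset of ↓(P ∖ ↑x), i.e. y ∉ (P ∖ ↑x)′.
-- Under the hypothesis this says y ∉ cl-σ (P ∖ ↑x), which classically means that y lies in
-- the Scott interior of ↑x. The converse inclusion holds in every poset: a Scott open
-- V ⊆ ↑x containing y ≤ ⋁D meets D.
module Submission where

open import Defs
open import Level using (Level; suc; lift; lower)
open import Relation.Binary.Bundles using (Poset)
open import Axiom.ExcludedMiddle using (ExcludedMiddle)
open import Axiom.DoubleNegationElimination using (DoubleNegationElimination; em⇒dne)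
open import Data.Product using (_,_; proj₂)
open import Relation.Unary using (_∈_; _∉_; _⊆_; ∁)
open import Relation.Nullary.Decidable using (map′)

em-lower : ∀ {ℓ} → ExcludedMiddle (suc ℓ) → ExcludedMiddle ℓ
em-lower em = map′ lower lift em

module ScottTopology {ℓ : Level} (P : Poset ℓ ℓ ℓ) where
  open Poset P renaming (Carrier to X)
  open PosetNotions P

  int-σ-↑⊆≪ : ∀ {x} → int-σ (↑ x) ⊆ (λ y → x ≪ y)
  int-σ-↑⊆≪ (V , (V-up , V-inacc) , V⊆↑x , y∈V) D D-dir s s-sup y≤s
    with V-inacc D D-dir s s-sup (V-up _ s y∈V y≤s)
  ... | d , d∈D , d∈V = d , d∈D , V⊆↑x d∈V

  ≪⇒∉-∁↑′ : ∀ {x y} → x ≪ y → y ∉ (∁ (↑ x)) ′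
  ≪⇒∉-∁↑′ x≪y (D , D-dir , D⊆↓∁↑x , y-sup)
    with x≪y D D-dir _ y-sup refl
  ... | d , d∈D , x≤d with D⊆↓∁↑x d∈D
  ...   | a , x≰a , d≤a = x≰a (trans x≤d d≤a)

  ∉int-σ⇒∈cl-σ-∁ : DoubleNegationElimination ℓ →
                   ∀ {U y} → y ∉ int-σ U → y ∈ cl-σ (∁ U)
  ∉int-σ⇒∈cl-σ-∁ dne {U} y∉intU C C-closed ∁U⊆C =
    dne λ y∉C → y∉intU (∁ C , C-closed , ∁C⊆U , y∉C)
    where
    ∁C⊆U : ∁ C ⊆ U
    ∁C⊆U z∉C = dne λ z∉U → z∉C (∁U⊆C z∉U)

theorem5p9 : ∀ {ℓ : Level} → ExcludedMiddle (suc ℓ) → (P : Poset ℓ ℓ ℓ) →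
    let open PosetNotions P in
    (∀ (A : Subset) → (A ′) ≐ cl-σ A) →
    ∀ (x : Poset.Carrier P) → int-σ (↑ x) ≐ (λ y → x ≪ y)
theorem5p9 em P ′≐cl-σ x = int-σ-↑⊆≪ , ≪⊆int-σ-↑
  where
  open PosetNotions P
  open ScottTopology P

  ≪⊆int-σ-↑ : (λ y → x ≪ y) ⊆ int-σ (↑ x)
  ≪⊆int-σ-↑ x≪y = em⇒dne em λ y∉int →
    ≪⇒∉-∁↑′ x≪y (proj₂ (′≐cl-σ (∁ (↑ x)))
                    (∉int-σ⇒∈cl-σ-∁ (em⇒dne (em-lower em)) y∉int))
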